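{- Let $q$ be a prime power, $k$ an integer, and let $C$ be a cover of $PG(3,q)$ consisting of $r=kq$ points and $s=q(q+1-k)$ planes. Then every plane of $PG(3,q)$ contains at least one line that contains no point of $C$.
   Context: $PG(v-1,q)$ is the projective space whose points, lines and planes are the $1$-, $2$- and $3$-dimensional subspaces of $GF(q)^v$; incidence is containment. A cover of $PG(v-1,q)$ is a set of points and planes such that every line is incident with at least one of these points or planes. -}

module Defs where

open import Level using (Level; _⊔_)
open import Data.Nat using (ℕ; zero; suc)
open import Data.Fin using (Fin; zero; suc)
open import Data.Product using (Σ; ∃; ∃-syntax; _×_; _,_)
open import Data.Sum using (_⊎_)
open import Relation.Nullary using (¬_)
open import Relation.Binary.PropositionalEquality using (_≡_)
open import Algebra.Bundles using (CommutativeRing)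

-- A finite field with exactly q elements (as a setoid).
-- Every finite field has prime-power order, and for every prime power q
-- there is (up to isomorphism) exactly one field GF(q) of order q.
record FiniteField (c ℓ : Level) (q : ℕ) : Set (Level.suc (c ⊔ ℓ)) where
  field
    commRing : CommutativeRing c ℓ
  open CommutativeRing commRing public hiding (ring)
  field
    0≉1      : ¬ (0# ≈ 1#)
    inverse  : ∀ x → ¬ (x ≈ 0#) → ∃[ y ] (x * y ≈ 1#)
    enum     : Fin q → Carrier
    enum-inj : ∀ i j → enum i ≈ enum j → i ≡ j
    enum-sur : ∀ x → ∃[ i ] (enum i ≈ x)

module Geometry {c ℓ : Level} {q : ℕ} (F : FiniteField c ℓ q) where
  open FiniteField F using (Carrier; _≈_; _+_; _*_; 0#)

  Vec : ℕ → Set c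
  Vec v = Fin v → Carrier

  ∑ : ∀ {k} → (Fin k → Carrier) → Carrier
  ∑ {zero}  f = 0#
  ∑ {suc k} f = f zero + ∑ (λ i → f (suc i))

  lincomb : ∀ {v k} → (Fin k → Carrier) → (Fin k → Vec v) → Vec v
  lincomb cs b i = ∑ (λ j → cs j * b j i)

  LinIndep : ∀ {v k} → (Fin k → Vec v) → Set (c ⊔ ℓ)
  LinIndep {v} {k} b = ∀ (cs : Fin k → Carrier) →
    (∀ i → lincomb cs b i ≈ 0#) → ∀ j → cs j ≈ 0#

  Subspace : ℕ → ℕ → Set (c ⊔ ℓ)
  Subspace v k = Σ (Fin k → Vec v) LinIndep

  basis : ∀ {v k} → Subspace v k → Fin k → Vec v
  basis (b , _) = b

  _∈S_ : ∀ {v k} → Vec v → Subspace v k → Set (c ⊔ ℓ)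
  _∈S_ {v} {k} x U = ∃[ cs ] (∀ i → x i ≈ lincomb cs (basis U) i)

  _⊆S_ : ∀ {v k m} → Subspace v k → Subspace v m → Set (c ⊔ ℓ)
  U ⊆S W = ∀ j → basis U j ∈S W

  _≐S_ : ∀ {v k m} → Subspace v k → Subspace v m → Set (c ⊔ ℓ)
  U ≐S W = (U ⊆S W) × (W ⊆S U)

  -- PG(v-1,q): points, lines, planes are 1-,2-,3-dim subspaces of GF(q)^v
  Point Line Plane : ℕ → Set (c ⊔ ℓ)
  Point v = Subspace v 1
  Line  v = Subspace v 2
  Plane v = Subspace v 3

  record Cover (v r s : ℕ) : Set (c ⊔ ℓ) where
    field
      pts       : Fin r → Point v
      pls       : Fin s → Plane v
      pts-dist  : ∀ i j → pts i ≐S pts j → i ≡ j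
      pls-dist  : ∀ i j → pls i ≐S pls j → i ≡ j
      covers    : ∀ (L : Line v) → (∃[ i ] (pts i ⊆S L)) ⊎ (∃[ j ] (L ⊆S pls j))

module Submission where

-- Suppose every line of the plane π contains a point of C. Write r = kq and s = qj, so j = q + 1 − k.
-- A point P off π and outside C lies on q² + q + 1 lines, each containing a point of C or lying in a
-- plane of C. Each point of C accounts for one of them, and each plane σ of C through P for at most q
-- lines avoiding C, because σ ∩ π is a line of π and therefore carries a point of C. Hence at least
-- j + 1 planes of C pass through P. As C has a point in π, more than q³ − r points off π lie outside C,
-- while a plane other than π has only q² points off π; so (j + 1)(q³ − r + 1) ≤ s q² = j q³, that is
-- q³ < (j + 1) r = q (j + 1)(q + 1 − j) ≤ q³, a contradiction. Everything here is finite and decidable,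
-- so refuting the supposition produces an explicit line of π missing the points of C.

open import Level using (Level; _⊔_)
open import Data.Nat.Base using (ℕ; suc)
open import Data.Fin.Base using (Fin)
open import Defs

module Counting where

  open import Function.Base using (_∘_)
  open import Data.Nat.Base using (ℕ; zero; suc; pred; _+_; _*_; _≤_; _<_; z≤n; s≤s)
  open import Data.Nat.Properties
    using (+-*-semiring; +-mono-≤; ≤-refl; ≤-trans; ≤-reflexive; m≤m+n; m≤n+m; *-zeroʳ; *-identityʳ)
  open import Data.Fin.Base using (Fin; zero; suc; punchOut; combine)
  open import Data.Fin.Properties
    using (0≢1+n; suc-injective; punchOut-injective; any?; combine-injectiveˡ; combine-injectiveʳ)
  open import Data.Product.Base using (∃-syntax; _,_)
  open import Data.Sum.Base using (_⊎_; inj₁; inj₂)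
  open import Relation.Nullary using (Dec; yes; no; contradiction)
  open import Relation.Unary using (Pred; Decidable)
  open import Relation.Binary.PropositionalEquality using (_≡_; _≢_; sym)
  open import Algebra.Properties.Semiring.Sum +-*-semiring using (sum; ∑-distrib-+; ∑-comm; *-distribˡ-sum)

  private
    variable
      a p q r : Level
      A B C : Set a
      n m : ℕ

  sum-mono : {f g : Fin n → ℕ} → (∀ i → f i ≤ g i) → sum f ≤ sum g
  sum-mono {zero}  _   = z≤n
  sum-mono {suc n} f≤g = +-mono-≤ (f≤g zero) (sum-mono (f≤g ∘ suc))

  sum-≤-* : ∀ {c} {f : Fin n → ℕ} → (∀ i → f i ≤ c) → sum f ≤ n * c
  sum-≤-* {zero}  _   = z≤n
  sum-≤-* {suc n} f≤c = +-mono-≤ (f≤c zero) (sum-≤-* (f≤c ∘ suc))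

  sum-≥-* : ∀ {c} {f : Fin n → ℕ} → (∀ i → c ≤ f i) → n * c ≤ sum f
  sum-≥-* {zero}  _   = z≤n
  sum-≥-* {suc n} c≤f = +-mono-≤ (c≤f zero) (sum-≥-* (c≤f ∘ suc))

  term≤sum : (f : Fin n → ℕ) (i : Fin n) → f i ≤ sum f
  term≤sum f zero    = m≤m+n _ _
  term≤sum f (suc i) = ≤-trans (term≤sum (f ∘ suc) i) (m≤n+m _ _)

  indicator : Dec A → ℕ
  indicator (yes _) = 1
  indicator (no _)  = 0

  indicator-mono : (A? : Dec A) (B? : Dec B) → (A → B) → indicator A? ≤ indicator B?
  indicator-mono (yes _) (yes _) _   = ≤-refl
  indicator-mono (yes a) (no ¬b) a→b = contradiction (a→b a) ¬b
  indicator-mono (no _)  _       _   = z≤n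

  indicator-⊎ : (A? : Dec A) (B? : Dec B) (C? : Dec C) → (A → B ⊎ C) →
                indicator A? ≤ indicator B? + indicator C?
  indicator-⊎ (no _)  _       _  _ = z≤n
  indicator-⊎ (yes _) (yes _) _  _ = s≤s z≤n
  indicator-⊎ (yes a) (no ¬b) C? f with f a
  ... | inj₁ b = contradiction b ¬b
  ... | inj₂ c = indicator-mono (yes a) C? (λ _ → c)

  count : {P : Pred (Fin n) p} → Decidable P → ℕ
  count P? = sum (λ i → indicator (P? i))

  module _ {P : Pred (Fin n) p} (P? : Decidable P) where

    count-mono : {Q : Pred (Fin n) q} (Q? : Decidable Q) → (∀ i → P i → Q i) → count P? ≤ count Q?
    count-mono Q? P⇒Q = sum-mono (λ i → indicator-mono (P? i) (Q? i) (P⇒Q i))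

    count-≤-if-inhabited : (∀ i → P i → count P? ≤ m) → count P? ≤ m
    count-≤-if-inhabited bound with any? P?
    ... | yes (i , p) = bound i p
    ... | no  ¬∃P     = ≤-trans (sum-≤-* (λ i → indicator-mono (P? i) (no ¬∃P) (i ,_)))
                                (≤-trans (≤-reflexive (*-zeroʳ n)) z≤n)

    count-≤-*-indicator : ∀ {c} (A? : Dec A) → (∀ i → P i → A) → (A → count P? ≤ c) →
                          count P? ≤ c * indicator A?
    count-≤-*-indicator {c = c} (yes a) _   bound = ≤-trans (bound a) (≤-reflexive (sym (*-identityʳ c)))
    count-≤-*-indicator         (no ¬a) P⇒A _     = count-≤-if-inhabited (λ i p → contradiction (P⇒A i p) ¬a)

    count-∪ : {Q : Pred (Fin n) q} {R : Pred (Fin n) r} (Q? : Decidable Q) (R? : Decidable R) →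
              (∀ i → P i → Q i ⊎ R i) → count P? ≤ count Q? + count R?
    count-∪ Q? R? P⇒Q∪R =
      ≤-trans (sum-mono (λ i → indicator-⊎ (P? i) (Q? i) (R? i) (P⇒Q∪R i)))
              (≤-reflexive (∑-distrib-+ (λ i → indicator (Q? i)) (λ i → indicator (R? i))))

    count-⋃ : ∀ {k} {Q : Fin k → Pred (Fin n) q} (Q? : ∀ j → Decidable (Q j)) →
              (∀ i → P i → ∃[ j ] Q j i) → count P? ≤ sum (λ j → count (Q? j))
    count-⋃ {Q = Q} Q? P⇒⋃Q = ≤-trans (sum-mono (λ i → indicator≤ i (P? i) (P⇒⋃Q i)))
                                      (≤-reflexive (∑-comm (λ i j → indicator (Q? j i))))
      where
      indicator≤ : ∀ i (A? : Dec A) → (A → ∃[ j ] Q j i) → indicator A? ≤ sum (λ j → indicator (Q? j i))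
      indicator≤ i (no _)  _ = z≤n
      indicator≤ i (yes a) f with j , qⱼ ← f a =
        ≤-trans (indicator-mono (yes a) (Q? j i) (λ _ → qⱼ)) (term≤sum (λ j → indicator (Q? j i)) j)

    *-count≤sum : ∀ c (f : Fin n → ℕ) → (∀ i → P i → c ≤ f i) → c * count P? ≤ sum f
    *-count≤sum c f P⇒c≤f = ≤-trans (≤-reflexive (*-distribˡ-sum c (λ i → indicator (P? i))))
                                     (sum-mono (λ i → c*indicator≤ (P? i) (P⇒c≤f i)))
      where
      c*indicator≤ : ∀ {x} (A? : Dec A) → (A → c ≤ x) → c * indicator A? ≤ x
      c*indicator≤ (yes a) le = ≤-trans (≤-reflexive (*-identityʳ c)) (le a)
      c*indicator≤ (no _)  _  = ≤-trans (≤-reflexive (*-zeroʳ c)) z≤n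

  count-cover : ∀ {P : Pred (Fin n) p} {Q : Pred (Fin n) q} (P? : Decidable P) (Q? : Decidable Q) →
                (∀ i → P i ⊎ Q i) → n ≤ count P? + count Q?
  count-cover {n} P? Q? P∪Q = ≤-trans (≤-reflexive (sym (*-identityʳ n)))
    (≤-trans (sum-≥-* (λ i → indicator-⊎ (yes (P∪Q i)) (P? i) (Q? i) (λ x → x)))
             (≤-reflexive (∑-distrib-+ (λ i → indicator (P? i)) (λ i → indicator (Q? i)))))

  ∑-count-comm : ∀ {k} {R : Fin n → Fin k → Set p} (R? : ∀ i j → Dec (R i j)) →
                 sum (λ i → count (R? i)) ≡ sum (λ j → count (λ i → R? i j))
  ∑-count-comm R? = ∑-comm (λ i j → indicator (R? i j))

  count-injective : {P : Pred (Fin n) p} (P? : Decidable P) (f : ∀ i → P i → Fin m) →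
                    (∀ {i j} (pᵢ : P i) (pⱼ : P j) → f i pᵢ ≡ f j pⱼ → i ≡ j) → count P? ≤ m
  count-injective-avoiding : {P : Pred (Fin n) p} (P? : Decidable P) (o : Fin m) (f : ∀ i → P i → Fin m) →
                             (∀ {i} (pᵢ : P i) → f i pᵢ ≢ o) →
                             (∀ {i j} (pᵢ : P i) (pⱼ : P j) → f i pᵢ ≡ f j pⱼ → i ≡ j) → count P? < m

  count-injective-avoiding {m = suc m} P? o f f≢o f-inj = s≤s (count-injective P? (λ i p → punchOut (f≢o p ∘ sym))
    (λ pᵢ pⱼ eq → f-inj pᵢ pⱼ (punchOut-injective (f≢o pᵢ ∘ sym) (f≢o pⱼ ∘ sym) eq)))

  count-injective {n = zero}  P? f f-inj = z≤n
  count-injective {n = suc n} P? f f-inj with P? zero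
  ... | no _   = count-injective (P? ∘ suc) (f ∘ suc) (λ pᵢ pⱼ eq → suc-injective (f-inj pᵢ pⱼ eq))
  ... | yes p₀ = count-injective-avoiding (P? ∘ suc) (f zero p₀) (f ∘ suc)
                   (λ p eq → 0≢1+n (f-inj p₀ p (sym eq))) (λ pᵢ pⱼ eq → suc-injective (f-inj pᵢ pⱼ eq))

  count-injective₂-avoiding : ∀ {k} {P : Pred (Fin n) p} (P? : Decidable P)
                              (g : ∀ i → P i → Fin k) (h : ∀ i → P i → Fin m) (o : Fin m) →
                              (∀ {i} (pᵢ : P i) → h i pᵢ ≢ o) →
                              (∀ {i j} (pᵢ : P i) (pⱼ : P j) → g i pᵢ ≡ g j pⱼ → h i pᵢ ≡ h j pⱼ → i ≡ j) →
                              count P? ≤ k * pred m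
  count-injective₂-avoiding {m = suc m} {P = P} P? g h o h≢o inj =
    count-injective P? (λ i p → combine (g i p) (h′ p)) λ pᵢ pⱼ eq →
      inj pᵢ pⱼ (combine-injectiveˡ (g _ pᵢ) (h′ pᵢ) (g _ pⱼ) (h′ pⱼ) eq)
                (punchOut-injective (h≢o pᵢ ∘ sym) (h≢o pⱼ ∘ sym)
                                    (combine-injectiveʳ (g _ pᵢ) (h′ pᵢ) (g _ pⱼ) (h′ pⱼ) eq))
    where
    h′ : ∀ {i} → P i → Fin m
    h′ p = punchOut (h≢o p ∘ sym)

module Arithmetic where

  open import Data.Nat.Base using (suc; _+_; _*_; _^_; _∸_; _≤_; _<_; z≤n; s≤s; pred; NonZero)
  open import Data.Nat.Properties
  open import Data.Integer.Base as ℤ using (ℤ; +_; -[1+_])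
  import Data.Integer.Properties as ℤ
  open import Data.Product.Base using (∃-syntax; _×_; _,_)
  open import Data.Sum.Base using (inj₁; inj₂)
  open import Data.Empty using (⊥)
  open import Relation.Binary.PropositionalEquality using (_≡_; sym; trans; cong; cong₂; subst; subst₂; module ≡-Reasoning)
  import Data.Nat.Tactic.RingSolver as ℕ-Ring
  import Data.Integer.Tactic.RingSolver as ℤ-Ring

  cover-parameters : ∀ q .{{_ : NonZero q}} r s (k : ℤ) →
                     + r ≡ k ℤ.* + q → + s ≡ + q ℤ.* (+ q ℤ.+ + 1 ℤ.- k) →
                     ∃[ j ] (s ≡ q * j × r + q * j ≡ q * (q + 1))
  cover-parameters q@(suc _) r s k r≡kq s≡q[q+1-k] with + q ℤ.+ + 1 ℤ.- k in eq
  ... | -[1+ _ ] with () ← s≡q[q+1-k]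
  ... | + j = j , ℤ.+-injective (trans s≡q[q+1-k] (sym (ℤ.pos-* q j))) , ℤ.+-injective (begin
    + (r + q * j)                               ≡⟨ ℤ.pos-+ r (q * j) ⟩
    + r ℤ.+ + (q * j)                           ≡⟨ cong₂ ℤ._+_ r≡kq (trans (ℤ.pos-* q j) (cong (+ q ℤ.*_) (sym eq))) ⟩
    k ℤ.* + q ℤ.+ + q ℤ.* (+ q ℤ.+ + 1 ℤ.- k)  ≡⟨ kq+q[q+1-k] k (+ q) ⟩
    + q ℤ.* (+ q ℤ.+ + 1)                       ≡⟨ cong (+ q ℤ.*_) (sym (ℤ.pos-+ q 1)) ⟩
    + q ℤ.* + (q + 1)                           ≡⟨ sym (ℤ.pos-* q (q + 1)) ⟩
    + (q * (q + 1))                             ∎)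
    where
    open ≡-Reasoning
    kq+q[q+1-k] : ∀ k q → k ℤ.* q ℤ.+ q ℤ.* (q ℤ.+ + 1 ℤ.- k) ≡ q ℤ.* (q ℤ.+ + 1)
    kq+q[q+1-k] = ℤ-Ring.solve-∀

  directions-bound⇒j<t : ∀ q r j t → 2 ≤ q → r + q * j ≡ q * (q + 1) →
                         q ^ 3 ≤ 1 + (r * pred q + q * pred q * t) → j < t
  directions-bound⇒j<t q@(suc p@(suc _)) r j t (s≤s (s≤s z≤n)) r+qj≡q[q+1] q³≤ = *-cancelˡ-< q j t (+-cancelˡ-≤ r _ _ (begin
    r + suc (q * j)     ≡⟨ +-suc r (q * j) ⟩
    suc (r + q * j)     ≡⟨ cong suc r+qj≡q[q+1] ⟩
    suc (q * (q + 1))   ≤⟨ *-cancelˡ-≤ p (+-cancelˡ-≤ 1 _ _ (subst₂ _≤_ (q³-expand p) (rearrange r t p) q³≤)) ⟩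
    r + q * t           ∎))
    where
    open ≤-Reasoning
    q³-expand : ∀ p → (1 + p) * ((1 + p) * ((1 + p) * 1)) ≡ 1 + p * (1 + (1 + p) * ((1 + p) + 1))
    q³-expand = ℕ-Ring.solve-∀
    rearrange : ∀ r t p → 1 + (r * p + (1 + p) * p * t) ≡ 1 + p * (r + (1 + p) * t)
    rearrange = ℕ-Ring.solve-∀

  private
    4ab≤[a+b]²-≤ : ∀ {a b} → a ≤ b → 4 * (a * b) ≤ (a + b) * (a + b)
    4ab≤[a+b]²-≤ {a} {b} a≤b = subst (λ b → 4 * (a * b) ≤ (a + b) * (a + b)) (m+[n∸m]≡n a≤b)
      (subst (4 * (a * (a + d)) ≤_) (square-split a d) (m≤n+m (4 * (a * (a + d))) (d * d)))
      where
      d = b ∸ a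
      square-split : ∀ a d → d * d + 4 * (a * (a + d)) ≡ (a + (a + d)) * (a + (a + d))
      square-split = ℕ-Ring.solve-∀

  4ab≤[a+b]² : ∀ a b → 4 * (a * b) ≤ (a + b) * (a + b)
  4ab≤[a+b]² a b with ≤-total a b
  ... | inj₁ a≤b = 4ab≤[a+b]²-≤ a≤b
  ... | inj₂ b≤a = subst₂ _≤_ (cong (4 *_) (*-comm b a)) (cong₂ _*_ (+-comm b a) (+-comm b a)) (4ab≤[a+b]²-≤ b≤a)

  a+b≡q+2⇒ab≤q² : ∀ q a b → 2 ≤ q → a + b ≡ q + 2 → a * b ≤ q * q
  a+b≡q+2⇒ab≤q² q a b 2≤q a+b≡q+2 = *-cancelˡ-≤ 4 (begin
    4 * (a * b)        ≤⟨ 4ab≤[a+b]² a b ⟩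
    (a + b) * (a + b)  ≡⟨ cong (λ x → x * x) a+b≡q+2 ⟩
    (q + 2) * (q + 2)  ≤⟨ *-mono-≤ q+2≤2q q+2≤2q ⟩
    (q + q) * (q + q)  ≡⟨ double-square q ⟩
    4 * (q * q)        ∎)
    where
    open ≤-Reasoning
    q+2≤2q = +-monoʳ-≤ q 2≤q
    double-square : ∀ q → (q + q) * (q + q) ≡ 4 * (q * q)
    double-square = ℕ-Ring.solve-∀

  -- With b = q + 1 ∸ j we have r = q b, and (j + 1) b ≤ q² because (j + 1) + b = q + 2.
  cover-counting-contradiction : ∀ q r s j n → 2 ≤ q → s ≡ q * j → r + q * j ≡ q * (q + 1) →
                                 q ^ 3 < n + r → suc j * n ≤ s * q ^ 2 → ⊥
  cover-counting-contradiction q@(suc _) r s j n 2≤q s≡qj r+qj≡q[q+1] q³<n+r [j+1]n≤sq² = <⇒≱ (begin-strict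
    suc j * q ^ 3                    <⟨ m<n+m (suc j * q ^ 3) (s≤s z≤n) ⟩
    suc j + suc j * q ^ 3            ≡⟨ *-suc (suc j) (q ^ 3) ⟨
    suc j * suc (q ^ 3)              ≤⟨ *-monoʳ-≤ (suc j) q³<n+r ⟩
    suc j * (n + r)                  ≡⟨ *-distribˡ-+ (suc j) n r ⟩
    suc j * n + suc j * r            ≤⟨ +-mono-≤ [j+1]n≤sq² (≤-reflexive (cong (suc j *_) r≡qb)) ⟩
    s * q ^ 2 + suc j * (q * b)      ≡⟨ cong₂ _+_ (cong (_* q ^ 2) s≡qj) (reassoc (suc j) q b) ⟩
    q * j * q ^ 2 + q * (suc j * b)  ≤⟨ +-monoʳ-≤ (q * j * q ^ 2) (*-monoʳ-≤ q [j+1]b≤q²) ⟩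
    q * j * q ^ 2 + q * (q * q)      ≡⟨ collect q j ⟩
    suc j * q ^ 3                    ∎) ≤-refl
    where
    open ≤-Reasoning
    j≤q+1 : j ≤ q + 1
    j≤q+1 = *-cancelˡ-≤ q (subst (q * j ≤_) r+qj≡q[q+1] (m≤n+m (q * j) r))
    b = q + 1 ∸ j
    j+b≡q+1 : j + b ≡ q + 1
    j+b≡q+1 = m+[n∸m]≡n j≤q+1
    r≡qb : r ≡ q * b
    r≡qb = +-cancelʳ-≡ (q * j) r (q * b) (begin-equality
      r + q * j        ≡⟨ r+qj≡q[q+1] ⟩
      q * (q + 1)      ≡⟨ cong (q *_) j+b≡q+1 ⟨
      q * (j + b)      ≡⟨ *-distribˡ-+ q j b ⟩
      q * j + q * b    ≡⟨ +-comm (q * j) (q * b) ⟩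
      q * b + q * j    ∎)
    [j+1]b≤q² : suc j * b ≤ q * q
    [j+1]b≤q² = a+b≡q+2⇒ab≤q² q (suc j) b 2≤q (trans (cong suc j+b≡q+1) (sym (+-suc q 1)))
    reassoc : ∀ a q b → a * (q * b) ≡ q * (a * b)
    reassoc = ℕ-Ring.solve-∀
    collect : ∀ q j → q * j * (q * (q * 1)) + q * (q * q) ≡ (1 + j) * (q * (q * (q * 1)))
    collect = ℕ-Ring.solve-∀

module LinearAlgebra {c ℓ : Level} {q : ℕ} (F : FiniteField c ℓ q) where

  open import Function.Base using (_∘_)
  open import Data.Nat.Base as ℕ using (zero; suc; _^_; _≤_; s≤s; z≤n; pred)
  import Data.Nat.Properties as ℕ
  open import Data.Fin.Base as Fin using (zero; suc)
  import Data.Fin.Properties as Fin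
  open import Data.Product.Base using (∃-syntax; _×_; _,_; proj₁; proj₂)
  open import Data.Sum.Base using (_⊎_; inj₁; inj₂)
  open import Data.Vec.Functional using ([]; _∷_; removeAt)
  open import Relation.Nullary using (Dec; yes; no; ¬_; ¬?; contradiction)
  open import Relation.Nullary.Decidable using (map′; _×-dec_)
  open import Relation.Unary using (Pred; Decidable)
  open import Relation.Binary.PropositionalEquality as ≡ using (_≡_; _≢_)
  open import Algebra.Bundles using (CommutativeRing)
  open Counting

  open FiniteField F hiding (zero)
  open Geometry F
  open import Algebra.Properties.Ring (CommutativeRing.ring commRing)
    using (-1*x≈-x; x∙y⁻¹≈ε⇒x≈y; x≈y⇒x∙y⁻¹≈ε; +-inverseˡ-unique)
  open import Algebra.Properties.Semiring.Sum semiring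
    using (sum; sum-cong-≋; ∑-distrib-+; ∑-comm; *-distribˡ-sum; *-distribʳ-sum; sum-replicate-zero)
  open import Data.Vec.Functional.Relation.Binary.Equality.Setoid setoid using (_≋_; ≋-refl; ≋-sym; ≋-trans)
  open import Relation.Binary.Reasoning.Setoid setoid

  private
    variable
      k m n : ℕ

  index : Carrier → Fin q
  index x = proj₁ (enum-sur x)

  enum-index : ∀ x → enum (index x) ≈ x
  enum-index x = proj₂ (enum-sur x)

  index-injective : ∀ {x y} → index x ≡ index y → x ≈ y
  index-injective {x} {y} eq = trans (sym (enum-index x)) (trans (reflexive (≡.cong enum eq)) (enum-index y))

  infix 4 _≟_
  _≟_ : ∀ x y → Dec (x ≈ y)
  x ≟ y = map′ index-injective
    (λ x≈y → enum-inj _ _ (trans (enum-index x) (trans x≈y (sym (enum-index y)))))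
    (index x Fin.≟ index y)

  2≤q : 2 ≤ q
  2≤q = Fin.injective⇒≤ {f = index 0# ∷ index 1# ∷ []} 0,1-injective
    where
    0,1-injective : ∀ {i j} → (index 0# ∷ index 1# ∷ []) i ≡ (index 0# ∷ index 1# ∷ []) j → i ≡ j
    0,1-injective {zero}     {zero}     _  = ≡.refl
    0,1-injective {zero}     {suc zero} eq = contradiction (index-injective eq) 0≉1
    0,1-injective {suc zero} {zero}     eq = contradiction (sym (index-injective eq)) 0≉1
    0,1-injective {suc zero} {suc zero} _  = ≡.refl

  q-nonZero : ℕ.NonZero q
  q-nonZero = ℕ.>-nonZero (ℕ.<-trans (s≤s z≤n) 2≤q)

  _⁻¹ : ∀ {x} → x ≉ 0# → Carrier
  x≉0 ⁻¹ = proj₁ (inverse _ x≉0)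

  ⁻¹-inverseˡ : ∀ {x} (x≉0 : x ≉ 0#) → x≉0 ⁻¹ * x ≈ 1#
  ⁻¹-inverseˡ {x} x≉0 = trans (*-comm _ x) (proj₂ (inverse x x≉0))

  *-cancelˡ : ∀ {a x y} → a ≉ 0# → a * x ≈ a * y → x ≈ y
  *-cancelˡ {a} {x} {y} a≉0 ax≈ay = begin
    x                    ≈⟨ *-identityˡ x ⟨
    1# * x               ≈⟨ *-congʳ (⁻¹-inverseˡ a≉0) ⟨
    (a≉0 ⁻¹ * a) * x     ≈⟨ *-assoc _ a x ⟩
    a≉0 ⁻¹ * (a * x)     ≈⟨ *-congˡ ax≈ay ⟩
    a≉0 ⁻¹ * (a * y)     ≈⟨ *-assoc _ a y ⟨
    (a≉0 ⁻¹ * a) * y     ≈⟨ *-congʳ (⁻¹-inverseˡ a≉0) ⟩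
    1# * y               ≈⟨ *-identityˡ y ⟩
    y                    ∎

  infixl 6 _+ᵥ_ _-ᵥ_
  infixr 7 _·_

  0ᵥ : Vec n
  0ᵥ _ = 0#

  _+ᵥ_ _-ᵥ_ : Vec n → Vec n → Vec n
  (u +ᵥ v) i = u i + v i
  (u -ᵥ v) i = u i - v i

  _·_ : Carrier → Vec n → Vec n
  (a · v) i = a * v i

  ∑≡sum : (f : Fin k → Carrier) → ∑ f ≡ sum f
  ∑≡sum {zero}  f = ≡.refl
  ∑≡sum {suc k} f = ≡.cong (f zero +_) (∑≡sum (f ∘ suc))

  ∑-cong : {f g : Fin k → Carrier} → (∀ i → f i ≈ g i) → ∑ f ≈ ∑ g
  ∑-cong {f = f} {g} f≈g = begin
    ∑ f    ≡⟨ ∑≡sum f ⟩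
    sum f  ≈⟨ sum-cong-≋ f≈g ⟩
    sum g  ≡⟨ ∑≡sum g ⟨
    ∑ g    ∎

  ∑-+ : (f g : Fin k → Carrier) → ∑ (λ i → f i + g i) ≈ ∑ f + ∑ g
  ∑-+ f g rewrite ∑≡sum (λ i → f i + g i) | ∑≡sum f | ∑≡sum g = ∑-distrib-+ f g

  ∑-*ˡ : ∀ a (f : Fin k → Carrier) → a * ∑ f ≈ ∑ (λ i → a * f i)
  ∑-*ˡ a f rewrite ∑≡sum f | ∑≡sum (λ i → a * f i) = *-distribˡ-sum a f

  ∑-*ʳ : ∀ a (f : Fin k → Carrier) → ∑ f * a ≈ ∑ (λ i → f i * a)
  ∑-*ʳ a f rewrite ∑≡sum f | ∑≡sum (λ i → f i * a) = *-distribʳ-sum a f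

  ∑-0 : ∀ k → ∑ {k} (λ _ → 0#) ≈ 0#
  ∑-0 k rewrite ∑≡sum {k} (λ _ → 0#) = sum-replicate-zero k

  ∑-swap : (f : Fin k → Fin m → Carrier) → ∑ (λ i → ∑ (f i)) ≈ ∑ (λ j → ∑ (λ i → f i j))
  ∑-swap f = begin
    ∑ (λ i → ∑ (f i))                ≈⟨ ∑-cong (λ i → reflexive (∑≡sum (f i))) ⟩
    ∑ (λ i → sum (f i))              ≡⟨ ∑≡sum (λ i → sum (f i)) ⟩
    sum (λ i → sum (f i))            ≈⟨ ∑-comm f ⟩
    sum (λ j → sum (λ i → f i j))    ≡⟨ ∑≡sum (λ j → sum (λ i → f i j)) ⟨
    ∑ (λ j → sum (λ i → f i j))      ≈⟨ ∑-cong (λ j → reflexive (≡.sym (∑≡sum (λ i → f i j)))) ⟩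
    ∑ (λ j → ∑ (λ i → f i j))        ∎

  lincomb-cong : ∀ {cs ds : Vec k} {f g : Fin k → Vec n} → cs ≋ ds → (∀ j → f j ≋ g j) →
                 lincomb cs f ≋ lincomb ds g
  lincomb-cong cs≋ds f≋g i = ∑-cong (λ j → *-cong (cs≋ds j) (f≋g j i))

  lincomb-congˡ : ∀ {cs ds : Vec k} (f : Fin k → Vec n) → cs ≋ ds → lincomb cs f ≋ lincomb ds f
  lincomb-congˡ f cs≋ds = lincomb-cong cs≋ds (λ _ _ → refl)

  lincomb-+ : ∀ (cs ds : Vec k) (f : Fin k → Vec n) → lincomb (cs +ᵥ ds) f ≋ lincomb cs f +ᵥ lincomb ds f
  lincomb-+ cs ds f i =
    trans (∑-cong (λ j → distribʳ (f j i) (cs j) (ds j))) (∑-+ (λ j → cs j * f j i) (λ j → ds j * f j i))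

  lincomb-· : ∀ a (cs : Vec k) (f : Fin k → Vec n) → lincomb (a · cs) f ≋ a · lincomb cs f
  lincomb-· a cs f i = trans (∑-cong (λ j → *-assoc a (cs j) (f j i))) (sym (∑-*ˡ a (λ j → cs j * f j i)))

  lincomb-- : ∀ (cs ds : Vec k) (f : Fin k → Vec n) → lincomb (cs -ᵥ ds) f ≋ lincomb cs f -ᵥ lincomb ds f
  lincomb-- cs ds f i = begin
    lincomb (cs -ᵥ ds) f i                      ≈⟨ lincomb-congˡ f (λ j → +-congˡ (sym (-1*x≈-x (ds j)))) i ⟩
    lincomb (cs +ᵥ (- 1#) · ds) f i             ≈⟨ lincomb-+ cs ((- 1#) · ds) f i ⟩
    lincomb cs f i + lincomb ((- 1#) · ds) f i  ≈⟨ +-congˡ (trans (lincomb-· (- 1#) ds f i) (-1*x≈-x _)) ⟩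
    lincomb cs f i - lincomb ds f i             ∎

  lincomb-0ᵥ : (f : Fin k → Vec n) → lincomb 0ᵥ f ≋ 0ᵥ
  lincomb-0ᵥ {k} f i = trans (∑-cong (λ j → zeroˡ (f j i))) (∑-0 k)

  lincomb-lincomb : ∀ (cs : Vec k) (M : Fin k → Vec m) (g : Fin m → Vec n) →
                    lincomb cs (λ j → lincomb (M j) g) ≋ lincomb (lincomb cs M) g
  lincomb-lincomb cs M g i = begin
    ∑ (λ j → cs j * ∑ (λ l → M j l * g l i))    ≈⟨ ∑-cong (λ j → ∑-*ˡ (cs j) (λ l → M j l * g l i)) ⟩
    ∑ (λ j → ∑ (λ l → cs j * (M j l * g l i)))  ≈⟨ ∑-swap (λ j l → cs j * (M j l * g l i)) ⟩
    ∑ (λ l → ∑ (λ j → cs j * (M j l * g l i)))  ≈⟨ ∑-cong (λ l → ∑-cong (λ j → *-assoc (cs j) (M j l) (g l i))) ⟨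
    ∑ (λ l → ∑ (λ j → cs j * M j l * g l i))    ≈⟨ ∑-cong (λ l → ∑-*ʳ (g l i) (λ j → cs j * M j l)) ⟨
    ∑ (λ l → lincomb cs M l * g l i)            ∎

  lincomb-[x] : ∀ cs (x : Vec n) → lincomb cs (x ∷ []) ≋ cs zero · x
  lincomb-[x] cs x i = +-identityʳ _

  std : Fin n → Vec n
  std zero    = 1# ∷ 0ᵥ
  std (suc j) = 0# ∷ std j

  std-diagonal : ∀ (j : Fin n) → std j j ≈ 1#
  std-diagonal zero    = refl
  std-diagonal (suc j) = std-diagonal j

  std-off-diagonal : ∀ {j l : Fin n} → l ≢ j → std j l ≈ 0#
  std-off-diagonal {j = zero}  {zero}  l≢j = contradiction ≡.refl l≢j
  std-off-diagonal {j = zero}  {suc l} _   = refl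
  std-off-diagonal {j = suc j} {zero}  _   = refl
  std-off-diagonal {j = suc j} {suc l} l≢j = std-off-diagonal (l≢j ∘ ≡.cong suc)

  lincomb-std : ∀ (cs : Vec n) → lincomb cs std ≋ cs
  lincomb-std {suc n} cs zero    = begin
    cs zero * 1# + lincomb (cs ∘ suc) (std ∘ suc) zero  ≈⟨ +-cong (*-identityʳ _) (∑-cong (λ j → zeroʳ (cs (suc j)))) ⟩
    cs zero + ∑ {n} (λ _ → 0#)                           ≈⟨ +-congˡ (∑-0 n) ⟩
    cs zero + 0#                                         ≈⟨ +-identityʳ _ ⟩
    cs zero                                              ∎
  lincomb-std {suc n} cs (suc i) = trans (+-cong (zeroʳ _) (lincomb-std (cs ∘ suc) i)) (+-identityˡ _)

  lincomb-by-std : ∀ (f : Fin k → Vec n) j → lincomb (std j) f ≋ f j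
  lincomb-by-std {suc k} f zero    i =
    trans (+-cong (*-identityˡ _) (trans (∑-cong (λ l → zeroˡ (f (suc l) i))) (∑-0 k))) (+-identityʳ _)
  lincomb-by-std {suc k} f (suc j) i = trans (+-cong (zeroˡ _) (lincomb-by-std (f ∘ suc) j i)) (+-identityˡ _)

  removeAt-≋ : ∀ {x y : Vec (suc n)} m → removeAt x m ≋ removeAt y m → x -ᵥ y ≋ (x m - y m) · std m
  removeAt-≋ {x = x} {y} m x≋y l with l Fin.≟ m
  ... | yes ≡.refl = sym (trans (*-congˡ (std-diagonal m)) (*-identityʳ _))
  ... | no  l≢m    = trans (x≈y⇒x∙y⁻¹≈ε (≡.subst (λ l → x l ≈ y l) (Fin.punchIn-punchOut (l≢m ∘ ≡.sym)) (x≋y _)))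
                           (sym (trans (*-congˡ (std-off-diagonal l≢m)) (zeroʳ _)))

  infix 4 _∈Span_
  _∈Span_ : Vec n → (Fin k → Vec n) → Set (c ⊔ ℓ)
  x ∈Span f = ∃[ cs ] (x ≋ lincomb cs f)

  ∈Span-resp-≋ : ∀ {x y : Vec n} {f : Fin k → Vec n} → x ≋ y → x ∈Span f → y ∈Span f
  ∈Span-resp-≋ x≋y (cs , x≋) = cs , ≋-trans (≋-sym x≋y) x≋

  ∈Span-cong : ∀ {x : Vec n} {f g : Fin k → Vec n} → (∀ j → f j ≋ g j) → x ∈Span f → x ∈Span g
  ∈Span-cong f≋g (cs , x≋) = cs , ≋-trans x≋ (lincomb-cong ≋-refl f≋g)

  ∈Span-member : ∀ (f : Fin k → Vec n) j → f j ∈Span f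
  ∈Span-member f j = std j , ≋-sym (lincomb-by-std f j)

  ∈Span-· : ∀ {x : Vec n} {f : Fin k → Vec n} a → x ∈Span f → a · x ∈Span f
  ∈Span-· {f = f} a (cs , x≋) = a · cs , λ i → trans (*-congˡ (x≋ i)) (sym (lincomb-· a cs f i))

  ·-cancelˡ : ∀ {a} (a≉0 : a ≉ 0#) (v : Vec n) → a≉0 ⁻¹ · (a · v) ≋ v
  ·-cancelˡ a≉0 v i = trans (sym (*-assoc _ _ (v i))) (trans (*-congʳ (⁻¹-inverseˡ a≉0)) (*-identityˡ (v i)))

  ∈Span-·⁻¹ : ∀ {x : Vec n} {f : Fin k → Vec n} {a} → a ≉ 0# → a · x ∈Span f → x ∈Span f
  ∈Span-·⁻¹ {x = x} a≉0 ax∈f = ∈Span-resp-≋ (·-cancelˡ a≉0 x) (∈Span-· (a≉0 ⁻¹) ax∈f)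

  ∈Span-- : ∀ {x y : Vec n} {f : Fin k → Vec n} → x ∈Span f → y ∈Span f → x -ᵥ y ∈Span f
  ∈Span-- {f = f} (cs , x≋) (ds , y≋) =
    cs -ᵥ ds , λ i → trans (+-cong (x≋ i) (-‿cong (y≋ i))) (sym (lincomb-- cs ds f i))

  ∈Span-trans : ∀ {x : Vec n} {f : Fin k → Vec n} {g : Fin m → Vec n} →
                x ∈Span f → (∀ j → f j ∈Span g) → x ∈Span g
  ∈Span-trans {f = f} {g} (cs , x≋) f⊆g =
    lincomb cs M , ≋-trans x≋ (≋-trans (lincomb-cong ≋-refl (proj₂ ∘ f⊆g)) (lincomb-lincomb cs M g))
    where
    M = proj₁ ∘ f⊆g

  ∈Span[x]-sym : ∀ {d w : Vec n} → ¬ d ≋ 0ᵥ → d ∈Span (w ∷ []) → w ∈Span (d ∷ [])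
  ∈Span[x]-sym {d = d} {w} d≉0 (cs , d≋) =
    ∈Span-·⁻¹ {f = d ∷ []} β≉0 (∈Span-resp-≋ {f = d ∷ []} d≋βw (∈Span-member (d ∷ []) zero))
    where
    d≋βw : d ≋ cs zero · w
    d≋βw = ≋-trans d≋ (lincomb-[x] cs w)
    β≉0 : cs zero ≉ 0#
    β≉0 β≈0 = d≉0 (λ i → trans (d≋βw i) (trans (*-congʳ β≈0) (zeroˡ (w i))))

  lincomb-injective : ∀ {f : Fin k → Vec n} → LinIndep f → ∀ {cs ds} → lincomb cs f ≋ lincomb ds f → cs ≋ ds
  lincomb-injective {f = f} f-indep {cs} {ds} eq j =
    x∙y⁻¹≈ε⇒x≈y _ _ (f-indep (cs -ᵥ ds) (λ i → trans (lincomb-- cs ds f i) (x≈y⇒x∙y⁻¹≈ε (eq i))) j)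

  LinIndep-resp : ∀ {f g : Fin k → Vec n} → (∀ j → f j ≋ g j) → LinIndep f → LinIndep g
  LinIndep-resp f≋g f-indep cs g≈0 = f-indep cs (λ i → trans (lincomb-cong ≋-refl f≋g i) (g≈0 i))

  std-LinIndep : LinIndep (std {n})
  std-LinIndep cs cs≈0 j = trans (sym (lincomb-std cs j)) (cs≈0 j)

  LinIndep-≉0ᵥ : ∀ {f : Fin k → Vec n} → LinIndep f → ∀ j → ¬ (f j ≋ 0ᵥ)
  LinIndep-≉0ᵥ {f = f} f-indep j fj≈0 =
    0≉1 (sym (trans (sym (std-diagonal j)) (f-indep (std j) (≋-trans (lincomb-by-std f j) fj≈0) j)))

  LinIndep-∷ : ∀ {x : Vec n} {f : Fin k → Vec n} → LinIndep f → ¬ x ∈Span f → LinIndep (x ∷ f)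
  LinIndep-∷ {x = x} {f} f-indep x∉f cs cs≈0 = coefficients≈0
    where
    rest = cs ∘ suc
    head≈0 : cs zero ≈ 0#
    head≈0 with cs zero ≟ 0#
    ... | yes c≈0 = c≈0
    ... | no  c≉0 = contradiction (∈Span-·⁻¹ c≉0 (∈Span-resp-≋ cx≈ (∈Span-· (- 1#) (rest , ≋-refl)))) x∉f
      where
      cx≈ : (- 1#) · lincomb rest f ≋ cs zero · x
      cx≈ i = trans (-1*x≈-x _) (sym (+-inverseˡ-unique _ _ (cs≈0 i)))
    coefficients≈0 : ∀ j → cs j ≈ 0#
    coefficients≈0 zero    = head≈0
    coefficients≈0 (suc j) = f-indep rest (λ i → trans (sym (drop-head i)) (cs≈0 i)) j
      where
      drop-head : ∀ i → cs zero * x i + lincomb rest f i ≈ lincomb rest f i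
      drop-head i = trans (+-congʳ (trans (*-congʳ head≈0) (zeroˡ (x i)))) (+-identityˡ _)

  LinIndep-[x] : ∀ {x : Vec n} → ¬ (x ≋ 0ᵥ) → LinIndep (x ∷ [])
  LinIndep-[x] x≉0 = LinIndep-∷ {f = []} (λ _ _ ()) (λ (_ , x≈0) → x≉0 x≈0)

  std₀₁-LinIndep : LinIndep (std {suc (suc n)} zero ∷ std (suc zero) ∷ [])
  std₀₁-LinIndep = LinIndep-∷ {f = std (suc zero) ∷ []} (LinIndep-[x] std₁≉0)
    λ (_ , std₀≋) → 0≉1 (sym (trans (std₀≋ zero) (trans (+-identityʳ _) (zeroʳ _))))
    where
    std₁≉0 : ¬ std {suc (suc n)} (suc zero) ≋ 0ᵥ
    std₁≉0 std₁≈0 = 0≉1 (sym (std₁≈0 (suc zero)))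

  -- Enumerating Fⁿ: vectors are coded by Fin (q ^ n), so counting over codes counts vectors.

  vec : Fin (q ^ n) → Vec n
  vec a i = enum (Fin.finToFun a i)

  code : Vec n → Fin (q ^ n)
  code v = Fin.funToFin (index ∘ v)

  vec-code : (v : Vec n) → vec (code v) ≋ v
  vec-code v i = trans (reflexive (≡.cong enum (Fin.finToFun-funToFin (index ∘ v) i))) (enum-index (v i))

  vec-injective : ∀ {a b : Fin (q ^ n)} → vec {n} a ≋ vec b → a ≡ b
  vec-injective {n} {a} {b} eq = ≡.trans (≡.sym (Fin.funToFin-finToFin {n} a))
    (≡.trans (funToFin-cong (λ i → enum-inj _ _ (eq i))) (Fin.funToFin-finToFin {n} b))
    where
    funToFin-cong : ∀ {m} {f g : Fin m → Fin q} → (∀ i → f i ≡ g i) → Fin.funToFin f ≡ Fin.funToFin g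
    funToFin-cong {zero}  _   = ≡.refl
    funToFin-cong {suc m} f≗g = ≡.cong₂ Fin.combine (f≗g zero) (funToFin-cong (f≗g ∘ suc))

  code-injective : ∀ {u v : Vec n} → code u ≡ code v → u ≋ v
  code-injective {n} {u} {v} eq =
    ≋-trans (≋-sym (vec-code u)) (≋-trans (λ i → reflexive (≡.cong (λ a → vec {n} a i) eq)) (vec-code v))

  ∃? : ∀ {p} {P : Vec n → Set p} → (∀ {u v} → u ≋ v → P u → P v) → (∀ a → Dec (P (vec a))) → Dec (∃[ v ] P v)
  ∃? resp P? with Fin.any? P?
  ... | yes (a , pa) = yes (vec a , pa)
  ... | no  ¬p       = no (λ (v , pv) → ¬p (code v , resp (≋-sym (vec-code v)) pv))

  infix 4 _≋?_
  _≋?_ : (u v : Vec n) → Dec (u ≋ v)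
  u ≋? v = Fin.all? (λ i → u i ≟ v i)

  ∈Span? : (x : Vec n) (f : Fin k → Vec n) → Dec (x ∈Span f)
  ∈Span? x f = ∃? (λ cs≋ds x≋ → ≋-trans x≋ (lincomb-congˡ f cs≋ds)) (λ a → x ≋? lincomb (vec a) f)

  LinIndep? : (f : Fin k → Vec n) → Dec (LinIndep f)
  LinIndep? {k} f = map′ ¬dependent⇒LinIndep (λ f-indep (cs , cs≈0 , cs≉0) → cs≉0 (f-indep cs cs≈0)) (¬? dependent?)
    where
    Dependent : Vec k → Set ℓ
    Dependent cs = lincomb cs f ≋ 0ᵥ × ¬ (cs ≋ 0ᵥ)
    dependent? : Dec (∃[ cs ] Dependent cs)
    dependent? = ∃? resp (λ a → lincomb (vec a) f ≋? 0ᵥ ×-dec ¬? (vec a ≋? 0ᵥ))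
      where
      resp : ∀ {cs ds} → cs ≋ ds → Dependent cs → Dependent ds
      resp cs≋ds (cs≈0 , cs≉0) = ≋-trans (lincomb-congˡ f (≋-sym cs≋ds)) cs≈0 , λ ds≈0 → cs≉0 (≋-trans cs≋ds ds≈0)
    ¬dependent⇒LinIndep : ¬ (∃[ cs ] Dependent cs) → LinIndep f
    ¬dependent⇒LinIndep ¬dep cs cs≈0 j with cs j ≟ 0#
    ... | yes csj≈0 = csj≈0
    ... | no  csj≉0 = contradiction (cs , cs≈0 , λ cs≋0 → csj≉0 (cs≋0 j)) ¬dep

  -- Over a finite field the dimension bound is a counting argument: coefficients give an
  -- injection Fin (q ^ m) → Fin (q ^ k).
  LinIndep-⊆Span⇒≤ : ∀ {u : Fin m → Vec n} {f : Fin k → Vec n} → LinIndep u → (∀ j → u j ∈Span f) → m ≤ k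
  LinIndep-⊆Span⇒≤ {m} {k = k} {u} {f} u-indep u⊆f = ℕ.≮⇒≥ (λ k<m → ℕ.<⇒≱ (ℕ.^-monoʳ-< q 2≤q k<m) q^m≤q^k)
    where
    M : Fin m → Vec k
    M = proj₁ ∘ u⊆f
    u≋ : ∀ cs → lincomb cs u ≋ lincomb (lincomb cs M) f
    u≋ cs = ≋-trans (lincomb-cong ≋-refl (proj₂ ∘ u⊆f)) (lincomb-lincomb cs M f)
    q^m≤q^k : q ^ m ≤ q ^ k
    q^m≤q^k = Fin.injective⇒≤ {f = λ a → code (lincomb (vec a) M)} λ {a} {b} eq → vec-injective
      (lincomb-injective u-indep (≋-trans (u≋ (vec a)) (≋-trans (lincomb-congˡ f (code-injective eq)) (≋-sym (u≋ (vec b))))))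

  LinIndep₂-∉Span[x] : ∀ {u v w : Vec n} → LinIndep (u ∷ v ∷ []) → ¬ u ∈Span (w ∷ []) ⊎ ¬ v ∈Span (w ∷ [])
  LinIndep₂-∉Span[x] {u = u} {v} {w} uv-indep with ∈Span? u (w ∷ []) | ∈Span? v (w ∷ [])
  ... | no u∉w  | _       = inj₁ u∉w
  ... | _       | no v∉w  = inj₂ v∉w
  ... | yes u∈w | yes v∈w = contradiction
        (LinIndep-⊆Span⇒≤ {u = u ∷ v ∷ []} {f = w ∷ []} uv-indep λ { zero → u∈w ; (suc zero) → v∈w })
        λ { (s≤s ()) }

  module _ {N p} {P : Pred (Fin N) p} (P? : Decidable P) where

    count-injective-Vec : (f : ∀ i → P i → Vec k) → (∀ {i j} (pᵢ : P i) (pⱼ : P j) → f i pᵢ ≋ f j pⱼ → i ≡ j) →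
                          count P? ≤ q ^ k
    count-injective-Vec f f-inj =
      count-injective P? (λ i p → code (f i p)) (λ pᵢ pⱼ eq → f-inj pᵢ pⱼ (code-injective eq))

    count-injective-nonzero : (f : ∀ i → P i → Carrier) → (∀ {i} (pᵢ : P i) → f i pᵢ ≉ 0#) →
                              (∀ {i j} (pᵢ : P i) (pⱼ : P j) → f i pᵢ ≈ f j pⱼ → i ≡ j) → count P? ≤ pred q
    count-injective-nonzero f f≉0 f-inj = ℕ.suc[m]≤n⇒m≤pred[n]
      (count-injective-avoiding P? (index 0#) (λ i p → index (f i p))
        (λ p eq → f≉0 p (index-injective eq)) (λ pᵢ pⱼ eq → f-inj pᵢ pⱼ (index-injective eq)))

    count-injective-×nonzero : (g h : ∀ i → P i → Carrier) → (∀ {i} (pᵢ : P i) → h i pᵢ ≉ 0#) →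
                               (∀ {i j} (pᵢ : P i) (pⱼ : P j) → g i pᵢ ≈ g j pⱼ → h i pᵢ ≈ h j pⱼ → i ≡ j) →
                               count P? ≤ q ℕ.* pred q
    count-injective-×nonzero g h h≉0 inj =
      count-injective₂-avoiding P? (λ i p → index (g i p)) (λ i p → index (h i p)) (index 0#)
        (λ p eq → h≉0 p (index-injective eq)) (λ pᵢ pⱼ eq₁ eq₂ → inj pᵢ pⱼ (index-injective eq₁) (index-injective eq₂))

  module _ {n p} {P : Pred (Fin (q ^ n)) p} (P? : Decidable P) where

    count-nonzero-multiples : ∀ {d₀ : Vec n} → (∀ a → P a → ¬ vec {n} a ≋ 0ᵥ × vec a ∈Span (d₀ ∷ [])) →
                              count P? ≤ pred q
    count-nonzero-multiples {d₀} P⇒ = count-injective-nonzero P? μ μ≉0 λ pₐ p_b μ≈μ′ →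
      vec-injective (≋-trans (vec≋ pₐ) (≋-trans (λ i → *-congʳ μ≈μ′) (≋-sym (vec≋ p_b))))
      where
      μ : ∀ a → P a → Carrier
      μ a pₐ = proj₁ (proj₂ (P⇒ a pₐ)) zero
      vec≋ : ∀ {a} (pₐ : P a) → vec {n} a ≋ μ a pₐ · d₀
      vec≋ {a} pₐ = ≋-trans (proj₂ (proj₂ (P⇒ a pₐ))) (lincomb-[x] (proj₁ (proj₂ (P⇒ a pₐ))) d₀)
      μ≉0 : ∀ {a} (pₐ : P a) → μ a pₐ ≉ 0#
      μ≉0 {a} pₐ μ≈0 = proj₁ (P⇒ a pₐ) (λ i → trans (vec≋ pₐ i) (trans (*-congʳ μ≈0) (zeroˡ (d₀ i))))

    count-∈Span₂-∉Span₁ : ∀ {u w : Vec n} → (∀ a → P a → vec {n} a ∈Span (u ∷ w ∷ []) × ¬ vec a ∈Span (w ∷ [])) →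
                          count P? ≤ q ℕ.* pred q
    count-∈Span₂-∉Span₁ {u} {w} P⇒ =
      count-injective-×nonzero P? (λ a pₐ → cs pₐ (suc zero)) (λ a pₐ → cs pₐ zero) cs₀≉0 λ pₐ p_b cs₁≈ cs₀≈ →
        vec-injective (≋-trans (vec≋ pₐ) (≋-trans
          (lincomb-congˡ {cs = cs pₐ} {ds = cs p_b} (u ∷ w ∷ []) λ { zero → cs₀≈ ; (suc zero) → cs₁≈ })
          (≋-sym (vec≋ p_b))))
      where
      cs : ∀ {a} → P a → Vec 2
      cs {a} pₐ = proj₁ (proj₁ (P⇒ a pₐ))
      vec≋ : ∀ {a} (pₐ : P a) → vec {n} a ≋ lincomb (cs pₐ) (u ∷ w ∷ [])
      vec≋ {a} pₐ = proj₂ (proj₁ (P⇒ a pₐ))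
      cs₀≉0 : ∀ {a} (pₐ : P a) → cs pₐ zero ≉ 0#
      cs₀≉0 {a} pₐ cs₀≈0 = proj₂ (P⇒ a pₐ) ((cs pₐ (suc zero) ∷ []) , λ i →
        trans (vec≋ pₐ i) (trans (+-congʳ (trans (*-congʳ cs₀≈0) (zeroˡ (u i)))) (+-identityˡ _)))

-- Coordinates adapted to a hyperplane b of F^(n+1): with e a vector outside b, W z = z₀ e + Σᵢ zᵢ₊₁ bᵢ.
-- The points off the hyperplane are the ⟨A x⟩ = ⟨e + Σ xᵢ bᵢ⟩, each with exactly one such
-- representative, and the points on it are the ⟨D d⟩ = ⟨Σ dᵢ bᵢ⟩.
module Coordinates {c ℓ : Level} {q : ℕ} (F : FiniteField c ℓ q) {n : ℕ}
  (b : Fin n → Geometry.Vec F (suc n)) (b-indep : Geometry.LinIndep F b) where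

  open import Function.Base using (_∘_)
  open import Data.Nat.Base using (zero; suc)
  import Data.Nat.Properties as ℕ
  open import Data.Fin.Base using (zero; suc)
  import Data.Fin.Properties as Fin
  open import Data.Product.Base using (∃-syntax; _,_; proj₁; proj₂)
  open import Data.Vec.Functional using ([]; _∷_)
  open import Relation.Nullary using (yes; no; ¬_; contradiction)
  open import Algebra.Bundles using (CommutativeRing)

  open FiniteField F hiding (zero)
  open Geometry F
  open LinearAlgebra F
  open import Algebra.Properties.Ring (CommutativeRing.ring commRing) using (+-cancelˡ)
  open import Data.Vec.Functional.Relation.Binary.Equality.Setoid setoid using (_≋_; ≋-refl; ≋-sym; ≋-trans)

  private
    variable
      k : ℕ

    -- Opaque: e is found by an exhaustive search that should never be unfolded.
    opaque
      outside : ∃[ e ] ¬ e ∈Span b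
      outside with Fin.all? (λ j → ∈Span? (std j) b)
      ... | yes std⊆b = contradiction (LinIndep-⊆Span⇒≤ std-LinIndep std⊆b) ℕ.1+n≰n
      ... | no ¬std⊆b with j , std∉b ← Fin.¬∀⟶∃¬ _ _ (λ j → ∈Span? (std j) b) ¬std⊆b = std j , std∉b

    frame : Fin (suc n) → Vec (suc n)
    frame = proj₁ outside ∷ b

  W : Vec (suc n) → Vec (suc n)
  W z = lincomb z frame

  W-cong : ∀ {y z} → y ≋ z → W y ≋ W z
  W-cong = lincomb-congˡ frame

  W-injective : ∀ {y z} → W y ≋ W z → y ≋ z
  W-injective = lincomb-injective {f = frame} (LinIndep-∷ b-indep (proj₂ outside))

  W-lincomb : ∀ cs (Y : Fin k → Vec (suc n)) → lincomb cs (W ∘ Y) ≋ W (lincomb cs Y)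
  W-lincomb cs Y = lincomb-lincomb cs Y frame

  W-LinIndep : ∀ {Y : Fin k → Vec (suc n)} → LinIndep Y → LinIndep (W ∘ Y)
  W-LinIndep {Y = Y} Y-indep cs WY≈0 =
    Y-indep cs (W-injective (≋-trans (≋-sym (W-lincomb cs Y)) (≋-trans WY≈0 (≋-sym (lincomb-0ᵥ frame)))))

  A D : Vec n → Vec (suc n)
  A x = W (1# ∷ x)
  D d = W (0# ∷ d)

  D≋lincomb : ∀ d → D d ≋ lincomb d b
  D≋lincomb d i = trans (+-congʳ (zeroˡ _)) (+-identityˡ _)

  D-cong : ∀ {d d′} → d ≋ d′ → D d ≋ D d′
  D-cong {d} {d′} d≋d′ = W-cong {y = 0# ∷ d} {z = 0# ∷ d′} λ { zero → refl ; (suc i) → d≋d′ i }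

  D-0ᵥ : ∀ {d} → d ≋ 0ᵥ → D d ≋ 0ᵥ
  D-0ᵥ {d} d≈0 = ≋-trans (D≋lincomb d) (≋-trans (lincomb-congˡ b d≈0) (lincomb-0ᵥ b))

  D-· : ∀ a d → D (a · d) ≋ a · D d
  D-· a d = ≋-trans (W-cong {y = 0# ∷ a · d} {z = a · (0# ∷ d)} λ { zero → sym (zeroʳ a) ; (suc i) → refl })
                    (lincomb-· a (0# ∷ d) frame)

  lincomb-D : ∀ cs (ds : Fin k → Vec n) → lincomb cs (D ∘ ds) ≋ D (lincomb cs ds)
  lincomb-D {k} cs ds = ≋-trans (W-lincomb cs (λ j → 0# ∷ ds j))
    (W-cong {y = lincomb cs (λ j → 0# ∷ ds j)} {z = 0# ∷ lincomb cs ds} λ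
      { zero    → trans (∑-cong (λ j → zeroʳ (cs j))) (∑-0 k)
      ; (suc i) → refl })

  D-∈Span : ∀ {w} {ds : Fin k → Vec n} → w ∈Span ds → D w ∈Span (D ∘ ds)
  D-∈Span {ds = ds} (cs , w≋) = cs , ≋-trans (D-cong w≋) (≋-sym (lincomb-D cs ds))

  D-LinIndep : ∀ {ds : Fin k → Vec n} → LinIndep ds → LinIndep (D ∘ ds)
  D-LinIndep {ds = ds} ds-indep = W-LinIndep {Y = λ j → 0# ∷ ds j} (λ cs eq → ds-indep cs (eq ∘ suc))

  A-ᵥA : ∀ x y → A x -ᵥ A y ≋ D (x -ᵥ y)
  A-ᵥA x y = ≋-trans (≋-sym (lincomb-- (1# ∷ x) (1# ∷ y) frame))
    (W-cong {y = (1# ∷ x) -ᵥ (1# ∷ y)} {z = 0# ∷ x -ᵥ y} λ { zero → -‿inverseʳ 1# ; (suc i) → refl })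

  ·A≋W : ∀ α x → α · A x ≋ W (α · (1# ∷ x))
  ·A≋W α x = ≋-sym (lincomb-· α (1# ∷ x) frame)

  ·A≋D⇒≈0 : ∀ {α x d} → α · A x ≋ D d → α ≈ 0#
  ·A≋D⇒≈0 {α} {x} {d} eq =
    trans (sym (*-identityʳ α)) (W-injective {y = α · (1# ∷ x)} {z = 0# ∷ d} (≋-trans (≋-sym (·A≋W α x)) eq) zero)

  ·A-injective : ∀ {α α′ x y} → α ≉ 0# → α · A x ≋ α′ · A y → x ≋ y
  ·A-injective {α} {α′} {x} {y} α≉0 eq i = *-cancelˡ α≉0 (trans (coordinates (suc i)) (*-congʳ (sym α≈α′)))
    where
    coordinates : α · (1# ∷ x) ≋ α′ · (1# ∷ y)
    coordinates = W-injective {y = α · (1# ∷ x)} {z = α′ · (1# ∷ y)}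
      (≋-trans (≋-sym (·A≋W α x)) (≋-trans eq (·A≋W α′ y)))
    α≈α′ : α ≈ α′
    α≈α′ = trans (sym (*-identityʳ α)) (trans (coordinates zero) (*-identityʳ α′))

  A∷D-LinIndep : ∀ {x} {ds : Fin k → Vec n} → LinIndep ds → LinIndep (A x ∷ D ∘ ds)
  A∷D-LinIndep {k} {x} {ds} ds-indep =
    LinIndep-resp {f = W ∘ Y} {g = A x ∷ D ∘ ds} (λ { zero → ≋-refl ; (suc j) → ≋-refl })
      (W-LinIndep {Y = Y} (LinIndep-∷ (λ cs eq → ds-indep cs (eq ∘ suc)) 1∷x∉0∷ds))
    where
    Y : Fin (suc k) → Vec (suc n)
    Y = (1# ∷ x) ∷ (λ j → 0# ∷ ds j)
    1∷x∉0∷ds : ¬ (1# ∷ x) ∈Span (λ j → 0# ∷ ds j)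
    1∷x∉0∷ds (cs , eq) = 0≉1 (sym (trans (eq zero) (trans (∑-cong (λ j → zeroʳ (cs j))) (∑-0 k))))

  directions-∈Span : ∀ {k x d} {σ : Fin (suc k) → Vec (suc n)} {us : Fin k → Vec n} →
                     LinIndep us → A x ∈Span σ → (∀ j → D (us j) ∈Span σ) → D d ∈Span σ → d ∈Span us
  directions-∈Span {x = x} {d} {σ} {us} us-indep Ax∈σ us⊆σ Dd∈σ with ∈Span? d us
  ... | yes d∈us = d∈us
  ... | no  d∉us = contradiction
        (LinIndep-⊆Span⇒≤ {u = A x ∷ D ∘ (d ∷ us)} {f = σ} (A∷D-LinIndep {x = x} {ds = d ∷ us} (LinIndep-∷ us-indep d∉us))
          λ { zero → Ax∈σ ; (suc zero) → Dd∈σ ; (suc (suc j)) → us⊆σ j })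
        ℕ.1+n≰n

  lineThrough : Vec n → Vec n → Fin 2 → Vec (suc n)
  lineThrough x d = A x ∷ D d ∷ []

  lineThrough-LinIndep : ∀ {x d} → ¬ d ≋ 0ᵥ → LinIndep (lineThrough x d)
  lineThrough-LinIndep {x} {d} d≉0 =
    LinIndep-resp {f = A x ∷ D ∘ (d ∷ [])} {g = lineThrough x d} (λ { zero → ≋-refl ; (suc zero) → ≋-refl })
      (A∷D-LinIndep {x = x} {ds = d ∷ []} (LinIndep-[x] d≉0))

  lincomb-lineThrough : ∀ α β x d → lincomb (α ∷ β ∷ []) (lineThrough x d) ≋ W (α ∷ α · x +ᵥ β · d)
  lincomb-lineThrough α β x d =
    ≋-trans (lincomb-cong {cs = α ∷ β ∷ []} {f = lineThrough x d} {g = W ∘ Y} ≋-refl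
                          λ { zero → ≋-refl ; (suc zero) → ≋-refl })
      (≋-trans (W-lincomb (α ∷ β ∷ []) Y) (W-cong {y = lincomb (α ∷ β ∷ []) Y} {z = α ∷ α · x +ᵥ β · d} λ
        { zero    → trans (+-cong (*-identityʳ α) (trans (+-identityʳ _) (zeroʳ β))) (+-identityʳ α)
        ; (suc i) → +-congˡ (+-identityʳ _) }))
    where
    Y : Fin 2 → Vec (suc n)
    Y = (1# ∷ x) ∷ (0# ∷ d) ∷ []

  lineThrough-coefficients : ∀ {α β α′ β′ x d d′} →
                             lincomb (α ∷ β ∷ []) (lineThrough x d) ≋ lincomb (α′ ∷ β′ ∷ []) (lineThrough x d′) →
                             β · d ≋ β′ · d′
  lineThrough-coefficients {α} {β} {α′} {β′} {x} {d} {d′} eq i =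
    +-cancelˡ (α * x i) _ _ (trans (coordinates (suc i)) (+-congʳ (*-congʳ (sym (coordinates zero)))))
    where
    coordinates : (α ∷ α · x +ᵥ β · d) ≋ (α′ ∷ α′ · x +ᵥ β′ · d′)
    coordinates = W-injective {y = α ∷ α · x +ᵥ β · d} {z = α′ ∷ α′ · x +ᵥ β′ · d′}
      (≋-trans (≋-sym (lincomb-lineThrough α β x d)) (≋-trans eq (lincomb-lineThrough α′ β′ x d′)))

  lineThrough-∈Span[A] : ∀ {α β x d y} → β ≈ 0# → y ≋ lincomb (α ∷ β ∷ []) (lineThrough x d) → y ∈Span (A x ∷ [])
  lineThrough-∈Span[A] {α} β≈0 y≋ =
    (α ∷ []) , λ i → trans (y≋ i) (+-congˡ (trans (+-identityʳ _) (trans (*-congʳ β≈0) (zeroˡ _))))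

module Hyperplanes {c ℓ : Level} {q : ℕ} (F : FiniteField c ℓ q) {n : ℕ}
  (b : Fin (suc n) → Geometry.Vec F (suc (suc n))) (b-indep : Geometry.LinIndep F b) where

  open import Function.Base using (_∘_)
  open import Data.Nat.Base using (zero; suc; _^_; _≤_)
  import Data.Nat.Properties as ℕ
  open import Data.Fin.Base using (zero; suc)
  import Data.Fin.Properties as Fin
  open import Data.Product.Base using (∃-syntax; _,_)
  open import Data.Vec.Functional using (_∷_; removeAt)
  open import Relation.Nullary using (Dec; yes; no; ¬_; ¬?; contradiction)
  open import Algebra.Bundles using (CommutativeRing)
  open Counting

  open FiniteField F hiding (zero)
  open Geometry F
  open LinearAlgebra F
  open Coordinates F b b-indep
  open import Algebra.Properties.Ring (CommutativeRing.ring commRing) using (x∙y⁻¹≈ε⇒x≈y)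
  open import Data.Vec.Functional.Relation.Binary.Equality.Setoid setoid using (_≋_; ≋-trans)

  -- If some D (std m) lies outside σ, two affine points of σ agreeing off coordinate m coincide;
  -- otherwise σ contains no affine point at all.
  count-A-∈Span : (σ : Fin (suc n) → Vec (suc (suc n))) → count (λ a → ∈Span? (A (vec a)) σ) ≤ q ^ n
  count-A-∈Span σ = by-direction-outside (Fin.any? (λ m → ¬? (∈Span? (D (std m)) σ)))
    where
    P? : ∀ a → Dec (A (vec a) ∈Span σ)
    P? a = ∈Span? (A (vec a)) σ

    by-direction-outside : Dec (∃[ m ] ¬ D (std m) ∈Span σ) → count P? ≤ q ^ n
    by-direction-outside (yes (m , Dm∉σ)) = count-injective-Vec P? (λ a _ → removeAt (vec a) m) λ {a} {b} Ax∈σ Ay∈σ eq →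
      vec-injective {suc n} {a} {b} (≋-of-removeAt Ax∈σ Ay∈σ (removeAt-≋ {x = vec a} {y = vec b} m eq))
      where
      ≋-of-removeAt : ∀ {x y} → A x ∈Span σ → A y ∈Span σ → x -ᵥ y ≋ (x m - y m) · std m → x ≋ y
      ≋-of-removeAt {x} {y} Ax∈σ Ay∈σ x-y≋ with x m - y m ≟ 0#
      ... | yes δ≈0 = λ i → x∙y⁻¹≈ε⇒x≈y _ _ (trans (x-y≋ i) (trans (*-congʳ δ≈0) (zeroˡ _)))
      ... | no  δ≉0 =
        contradiction (∈Span-·⁻¹ {f = σ} δ≉0 (∈Span-resp-≋ {f = σ} Ax-Ay≋ (∈Span-- {f = σ} Ax∈σ Ay∈σ))) Dm∉σ
        where
        Ax-Ay≋ : A x -ᵥ A y ≋ (x m - y m) · D (std m)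
        Ax-Ay≋ = ≋-trans (A-ᵥA x y) (≋-trans (D-cong x-y≋) (D-· (x m - y m) (std m)))
    by-direction-outside (no ¬outside) = count-≤-if-inhabited P? λ a Ax∈σ → contradiction
      (LinIndep-⊆Span⇒≤ {u = A (vec a) ∷ D ∘ std} {f = σ} (A∷D-LinIndep {x = vec a} {ds = std} std-LinIndep)
                        λ { zero → Ax∈σ ; (suc m) → D-std∈σ m })
      ℕ.1+n≰n
      where
      D-std∈σ : ∀ m → D (std m) ∈Span σ
      D-std∈σ m with ∈Span? (D (std m)) σ
      ... | yes Dm∈σ = Dm∈σ
      ... | no  Dm∉σ = contradiction (m , Dm∉σ) ¬outside

module CoverArgument {c ℓ : Level} {q : ℕ} (F : FiniteField c ℓ q) {r s : ℕ}
  (C : Geometry.Cover F 4 r s) (π : Geometry.Plane F 4) where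

  open import Function.Base using (_∘_)
  open import Data.Nat.Base as ℕ using (zero; suc; _^_; _≤_; _<_; pred)
  import Data.Nat.Properties as ℕ
  open import Data.Fin.Base using (zero; suc)
  import Data.Fin.Properties as Fin
  open import Data.Product.Base using (Σ-syntax; ∃-syntax; _×_; _,_; proj₁; proj₂)
  open import Data.Sum.Base using (_⊎_; inj₁; inj₂; [_,_]′)
  open import Data.Vec.Functional using ([]; _∷_)
  open import Data.Empty using (⊥)
  open import Relation.Nullary using (Dec; yes; no; ¬_; ¬?; contradiction)
  open import Relation.Nullary.Decidable using (_×-dec_; _⊎-dec_; toSum)
  open import Relation.Binary.PropositionalEquality as ≡ using (_≡_; _≢_)
  open import Algebra.Properties.Semiring.Sum ℕ.+-*-semiring using (sum; *-distribˡ-sum)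
  open Counting
  open Arithmetic

  open FiniteField F hiding (zero)
  open Geometry F
  open LinearAlgebra F
  open Coordinates F (basis π) (proj₂ π)
  open Hyperplanes F (basis π) (proj₂ π) using (count-A-∈Span)
  open Cover C
  open import Data.Vec.Functional.Relation.Binary.Equality.Setoid setoid using (_≋_; ≋-refl; ≋-sym; ≋-trans)

  pt : Fin r → Vec 4
  pt i = basis (pts i) zero

  pt-≉0ᵥ : ∀ i → ¬ pt i ≋ 0ᵥ
  pt-≉0ᵥ i = LinIndep-≉0ᵥ {f = basis (pts i)} (proj₂ (pts i)) zero

  MeetsC : ∀ {k} → (Fin k → Vec 4) → Set (c ⊔ ℓ)
  MeetsC f = ∃[ i ] pt i ∈Span f

  meetsC? : ∀ {k} (f : Fin k → Vec 4) → Dec (MeetsC f)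
  meetsC? f = Fin.any? (λ i → ∈Span? (pt i) f)

  EveryLineOfπMeetsC : Set (c ⊔ ℓ)
  EveryLineOfπMeetsC = ∀ u v → LinIndep (u ∷ v ∷ []) → MeetsC (D ∘ (u ∷ v ∷ []))

  LineOfπAvoidingC : Vec 3 → Vec 3 → Set (c ⊔ ℓ)
  LineOfπAvoidingC u v = LinIndep (u ∷ v ∷ []) × ¬ MeetsC (D ∘ (u ∷ v ∷ []))

  line-of-π-avoiding-C? : Dec (∃[ u ] ∃[ v ] LineOfπAvoidingC u v)
  line-of-π-avoiding-C? =
    ∃? (λ u≋u′ (v , avoiding) → v , resp u≋u′ ≋-refl avoiding) λ a →
    ∃? (λ v≋v′ avoiding → resp ≋-refl v≋v′ avoiding) λ b →
    LinIndep? (vec a ∷ vec b ∷ []) ×-dec ¬? (meetsC? (D ∘ (vec a ∷ vec b ∷ [])))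
    where
    resp : ∀ {u u′ v v′} → u ≋ u′ → v ≋ v′ → LineOfπAvoidingC u v → LineOfπAvoidingC u′ v′
    resp {u} {u′} {v} {v′} u≋u′ v≋v′ (uv-indep , ¬meets) =
      LinIndep-resp {f = u ∷ v ∷ []} {g = u′ ∷ v′ ∷ []} uv≋ uv-indep ,
      λ (i , pt∈) → ¬meets (i , ∈Span-cong {f = D ∘ (u′ ∷ v′ ∷ [])} {g = D ∘ (u ∷ v ∷ [])}
                                            (λ j → D-cong (≋-sym (uv≋ j))) pt∈)
      where
      uv≋ : ∀ j → (u ∷ v ∷ []) j ≋ (u′ ∷ v′ ∷ []) j
      uv≋ zero       = u≋u′
      uv≋ (suc zero) = v≋v′

  line-of-π-avoiding-C : ¬ EveryLineOfπMeetsC → Σ[ L ∈ Line 4 ] (L ⊆S π × (∀ i → ¬ pts i ⊆S L))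
  line-of-π-avoiding-C ¬every with line-of-π-avoiding-C?
  ... | yes (u , v , uv-indep , ¬meets) =
        (D ∘ (u ∷ v ∷ []) , D-LinIndep {ds = u ∷ v ∷ []} uv-indep) ,
        (λ j → (u ∷ v ∷ []) j , D≋lincomb ((u ∷ v ∷ []) j)) ,
        λ i pt⊆L → ¬meets (i , pt⊆L zero)
  ... | no ¬avoiding = contradiction every ¬every
    where
    every : EveryLineOfπMeetsC
    every u v uv-indep with meetsC? (D ∘ (u ∷ v ∷ []))
    ... | yes meets = meets
    ... | no ¬meets = contradiction (u , v , uv-indep , ¬meets) ¬avoiding

  module _ (every : EveryLineOfπMeetsC) where

    C-point-on-line : ∀ {u v} → LinIndep (u ∷ v ∷ []) →
                      ∃[ i ] ∃[ w ] (pt i ≋ D w × ¬ w ≋ 0ᵥ × w ∈Span (u ∷ v ∷ []))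
    C-point-on-line {u} {v} uv-indep with i , cs , pt≋ ← every u v uv-indep =
      i , lincomb cs (u ∷ v ∷ []) , pt≋Dw , (λ w≈0 → pt-≉0ᵥ i (≋-trans pt≋Dw (D-0ᵥ w≈0))) , (cs , ≋-refl)
      where
      pt≋Dw = ≋-trans pt≋ (lincomb-D cs (u ∷ v ∷ []))

    C-point-at-A : ∀ {i x} → pt i ∈Span (A x ∷ []) → ∃[ α ] (α ≉ 0# × pt i ≋ α · A x)
    C-point-at-A {i} {x} (cs , pt≋) = cs zero , α≉0 , pt≋α·A
      where
      pt≋α·A : pt i ≋ cs zero · A x
      pt≋α·A = ≋-trans pt≋ (lincomb-[x] cs (A x))
      α≉0 : cs zero ≉ 0#
      α≉0 α≈0 = pt-≉0ᵥ i (λ k → trans (pt≋α·A k) (trans (*-congʳ α≈0) (zeroˡ _)))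

    inC? : ∀ a → Dec (MeetsC (A (vec a) ∷ []))
    inC? a = meetsC? (A (vec a) ∷ [])

    -- C has a point in π, and distinct affine points of C are distinct points of C.
    count-C-off-π : count inC? < r
    count-C-off-π = count-injective-avoiding inC? i₀ (λ _ → proj₁) ≢i₀ injective
      where
      C-point-in-π = C-point-on-line (std₀₁-LinIndep {1})
      i₀ = proj₁ C-point-in-π
      w₀ = proj₁ (proj₂ C-point-in-π)
      pt≋Dw₀ : pt i₀ ≋ D w₀
      pt≋Dw₀ = proj₁ (proj₂ (proj₂ C-point-in-π))
      ≢i₀ : ∀ {a} (a∈C : MeetsC (A (vec a) ∷ [])) → proj₁ a∈C ≢ i₀
      ≢i₀ {a} (i , pt∈) ≡.refl with α , α≉0 , pt≋ ← C-point-at-A {i} {vec a} pt∈ =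
        α≉0 (·A≋D⇒≈0 {α} {vec a} {w₀} (≋-trans (≋-sym pt≋) pt≋Dw₀))
      injective : ∀ {a b} (a∈C : MeetsC (A (vec a) ∷ [])) (b∈C : MeetsC (A (vec b) ∷ [])) →
                  proj₁ a∈C ≡ proj₁ b∈C → a ≡ b
      injective {a} {b} (i , pt∈) (.i , pt∈′) ≡.refl
        with α , α≉0 , pt≋ ← C-point-at-A {i} {vec a} pt∈ | α′ , _ , pt≋′ ← C-point-at-A {i} {vec b} pt∈′ =
        vec-injective {3} {a} {b} (·A-injective {α} {α′} {vec a} {vec b} α≉0 (≋-trans (≋-sym pt≋) pt≋′))

    ThroughC : Vec 3 → Fin r → Vec 3 → Set (c ⊔ ℓ)
    ThroughC x i d = ¬ d ≋ 0ᵥ × pt i ∈Span lineThrough x d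

    throughC? : ∀ x i a → Dec (ThroughC x i (vec a))
    throughC? x i a = ¬? (vec a ≋? 0ᵥ) ×-dec ∈Span? (pt i) (lineThrough x (vec a))

    -- pt i = α A x + β D d with β ≉ 0 since x ∉ C, and β determines d.
    count-ThroughC : ∀ {x} → ¬ MeetsC (A x ∷ []) → ∀ i → count (throughC? x i) ≤ pred q
    count-ThroughC {x} x∉C i = count-injective-nonzero (throughC? x i) β β≉0 injective
      where
      β : ∀ a → ThroughC x i (vec a) → Carrier
      β a (_ , cs , _) = cs (suc zero)
      β≉0 : ∀ {a} (t : ThroughC x i (vec a)) → β a t ≉ 0#
      β≉0 {a} (_ , cs , pt≋) β≈0 = x∉C (i , lineThrough-∈Span[A] {cs zero} {cs (suc zero)} {x} {vec a} β≈0 pt≋)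
      injective : ∀ {a b} (tₐ : ThroughC x i (vec a)) (t_b : ThroughC x i (vec b)) → β a tₐ ≈ β b t_b → a ≡ b
      injective {a} {b} tₐ@(_ , cs , pt≋) (_ , cs′ , pt≋′) β≈β′ = vec-injective λ k → *-cancelˡ (β≉0 tₐ)
        (trans (lineThrough-coefficients {cs zero} {cs (suc zero)} {cs′ zero} {cs′ (suc zero)} {x} {vec a} {vec b}
                                          (≋-trans (≋-sym pt≋) pt≋′) k)
               (*-congʳ (sym β≈β′)))

    InPlaneAvoidingC : (Fin 3 → Vec 4) → Vec 3 → Vec 3 → Set (c ⊔ ℓ)
    InPlaneAvoidingC σ x d = D d ∈Span σ × ¬ d ≋ 0ᵥ × ¬ MeetsC (lineThrough x d)

    inPlaneAvoidingC? : ∀ σ x a → Dec (InPlaneAvoidingC σ x (vec a))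
    inPlaneAvoidingC? σ x a = ∈Span? (D (vec a)) σ ×-dec ¬? (vec a ≋? 0ᵥ) ×-dec ¬? (meetsC? (lineThrough x (vec a)))

    meets-lineThrough : ∀ {i x d w} → pt i ≋ D w → w ∈Span (d ∷ []) → MeetsC (lineThrough x d)
    meets-lineThrough {i} {x} {d} pt≋Dw w∈d =
      i , ∈Span-trans {f = D ∘ (d ∷ [])} {g = lineThrough x d}
            (∈Span-resp-≋ {f = D ∘ (d ∷ [])} (≋-sym pt≋Dw) (D-∈Span {ds = d ∷ []} w∈d))
            λ { zero → ∈Span-member (lineThrough x d) (suc zero) }

    -- If σ ∩ π contains two independent directions d₀, u, it is a line of π and so carries a point
    -- ⟨D w⟩ of C; the wanted directions then lie in span(u′, w) but not in span(w), for u′ ∈ {u, d₀}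
    -- outside span(w). Otherwise they are all multiples of d₀.
    count-InPlaneAvoidingC : ∀ {x} (σ : Fin 3 → Vec 4) → A x ∈Span σ → count (inPlaneAvoidingC? σ x) ≤ q ℕ.* pred q
    count-InPlaneAvoidingC {x} σ Ax∈σ = count-≤-if-inhabited P? λ a₀ (Dd₀∈σ , d₀≉0 , _) →
      by-second-direction Dd₀∈σ d₀≉0
        (∃? {P = SecondDirection (vec a₀)} resp (λ a → ∈Span? (D (vec a)) σ ×-dec LinIndep? (vec a ∷ vec a₀ ∷ [])))
      where
      P? : ∀ a → Dec (InPlaneAvoidingC σ x (vec a))
      P? = inPlaneAvoidingC? σ x

      SecondDirection : Vec 3 → Vec 3 → Set (c ⊔ ℓ)
      SecondDirection d₀ u = D u ∈Span σ × LinIndep (u ∷ d₀ ∷ [])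

      resp : ∀ {d₀ u u′} → u ≋ u′ → SecondDirection d₀ u → SecondDirection d₀ u′
      resp {d₀} {u} {u′} u≋u′ (Du∈σ , ud₀-indep) =
        ∈Span-resp-≋ {f = σ} (D-cong u≋u′) Du∈σ ,
        LinIndep-resp {f = u ∷ d₀ ∷ []} {g = u′ ∷ d₀ ∷ []} (λ { zero → u≋u′ ; (suc zero) → ≋-refl }) ud₀-indep

      off-C-point : ∀ {i w u} → pt i ≋ D w → ¬ w ≋ 0ᵥ → D w ∈Span σ → D u ∈Span σ → ¬ u ∈Span (w ∷ []) →
                    count P? ≤ q ℕ.* pred q
      off-C-point {i} {w} {u} pt≋Dw w≉0 Dw∈σ Du∈σ u∉w = count-∈Span₂-∉Span₁ P? {u} {w} λ a (Dd∈σ , d≉0 , ¬meets) →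
        directions-∈Span {x = x} {d = vec a} {σ = σ} {us = u ∷ w ∷ []} uw-indep Ax∈σ
                         (λ { zero → Du∈σ ; (suc zero) → Dw∈σ }) Dd∈σ ,
        λ d∈w → ¬meets (meets-lineThrough {i} {x} {vec a} {w} pt≋Dw (∈Span[x]-sym {d = vec a} {w} d≉0 d∈w))
        where
        uw-indep = LinIndep-∷ {x = u} {f = w ∷ []} (LinIndep-[x] w≉0) u∉w

      by-second-direction : ∀ {d₀} → D d₀ ∈Span σ → ¬ d₀ ≋ 0ᵥ → Dec (∃[ u ] SecondDirection d₀ u) →
                            count P? ≤ q ℕ.* pred q
      by-second-direction {d₀} Dd₀∈σ d₀≉0 (no ¬second) =
        ℕ.≤-trans (count-nonzero-multiples P? {d₀} λ a (Dd∈σ , d≉0 , _) → d≉0 , multiple Dd∈σ)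
                  (ℕ.m≤n*m (pred q) q {{q-nonZero}})
        where
        multiple : ∀ {d} → D d ∈Span σ → d ∈Span (d₀ ∷ [])
        multiple {d} Dd∈σ with ∈Span? d (d₀ ∷ [])
        ... | yes d∈d₀ = d∈d₀
        ... | no  d∉d₀ = contradiction (d , Dd∈σ , LinIndep-∷ {x = d} {f = d₀ ∷ []} (LinIndep-[x] d₀≉0) d∉d₀) ¬second
      by-second-direction {d₀} Dd₀∈σ d₀≉0 (yes (u , Du∈σ , ud₀-indep)) =
        via-C-point (C-point-on-line {u} {d₀} ud₀-indep)
        where
        via-C-point : ∃[ i ] ∃[ w ] (pt i ≋ D w × ¬ w ≋ 0ᵥ × w ∈Span (u ∷ d₀ ∷ [])) → count P? ≤ q ℕ.* pred q
        via-C-point (i , w , pt≋Dw , w≉0 , w∈ud₀) =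
          [ off-C-point {i} {w} {u} pt≋Dw w≉0 Dw∈σ Du∈σ , off-C-point {i} {w} {d₀} pt≋Dw w≉0 Dw∈σ Dd₀∈σ ]′
            (LinIndep₂-∉Span[x] {u = u} {d₀} {w} ud₀-indep)
          where
          Dw∈σ : D w ∈Span σ
          Dw∈σ = ∈Span-trans {f = D ∘ (u ∷ d₀ ∷ [])} {g = σ} (D-∈Span {ds = u ∷ d₀ ∷ []} w∈ud₀)
                   λ { zero → Du∈σ ; (suc zero) → Dd₀∈σ }

    planes-through : Vec 3 → ℕ
    planes-through x = count (λ j → ∈Span? (A x) (basis (pls j)))

    InPlaneOfC : Vec 3 → Vec 3 → Set (c ⊔ ℓ)
    InPlaneOfC x d = ∃[ j ] (A x ∈Span basis (pls j) × InPlaneAvoidingC (basis (pls j)) x d)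

    direction-cases : ∀ x d → d ≋ 0ᵥ ⊎ (∃[ i ] ThroughC x i d) ⊎ InPlaneOfC x d
    direction-cases x d = [ inj₁ , (λ d≉0 → inj₂ (nonzero d≉0)) ]′ (toSum (d ≋? 0ᵥ))
      where
      L : ¬ d ≋ 0ᵥ → Line 4
      L d≉0 = lineThrough x d , lineThrough-LinIndep {x} {d} d≉0
      in-plane : (d≉0 : ¬ d ≋ 0ᵥ) → ¬ MeetsC (lineThrough x d) →
                 (∃[ i ] pts i ⊆S L d≉0) ⊎ (∃[ j ] L d≉0 ⊆S pls j) → InPlaneOfC x d
      in-plane d≉0 ¬meets (inj₁ (i , pt⊆L)) = contradiction (i , pt⊆L zero) ¬meets
      in-plane d≉0 ¬meets (inj₂ (j , L⊆σ))  = j , L⊆σ zero , L⊆σ (suc zero) , d≉0 , ¬meets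
      nonzero : ¬ d ≋ 0ᵥ → (∃[ i ] ThroughC x i d) ⊎ InPlaneOfC x d
      nonzero d≉0 = [ (λ (i , pt∈) → inj₁ (i , d≉0 , pt∈))
                    , (λ ¬meets → inj₂ (in-plane d≉0 ¬meets (covers (L d≉0))))
                    ]′ (toSum (meetsC? (lineThrough x d)))

    ∃throughC? : ∀ x a → Dec (∃[ i ] ThroughC x i (vec a))
    ∃throughC? x a = Fin.any? (λ i → throughC? x i a)

    inPlaneOf? : ∀ x j a → Dec (A x ∈Span basis (pls j) × InPlaneAvoidingC (basis (pls j)) x (vec a))
    inPlaneOf? x j a = ∈Span? (A x) (basis (pls j)) ×-dec inPlaneAvoidingC? (basis (pls j)) x a

    inPlaneOfC? : ∀ x a → Dec (InPlaneOfC x (vec a))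
    inPlaneOfC? x a = Fin.any? (λ j → inPlaneOf? x j a)

    count-zero-vector : count (λ a → vec {3} a ≋? 0ᵥ) ≤ 1
    count-zero-vector = count-injective-Vec (λ a → vec {3} a ≋? 0ᵥ) (λ _ _ → [])
      (λ {a} {b} a≈0 b≈0 _ → vec-injective {3} {a} {b} (≋-trans a≈0 (≋-sym b≈0)))

    count-∃ThroughC : ∀ {x} → ¬ MeetsC (A x ∷ []) → count (∃throughC? x) ≤ r ℕ.* pred q
    count-∃ThroughC {x} x∉C =
      ℕ.≤-trans (count-⋃ (∃throughC? x) (throughC? x) (λ _ h → h)) (sum-≤-* (count-ThroughC {x} x∉C))

    count-InPlaneOfC : ∀ {x} → count (inPlaneOfC? x) ≤ q ℕ.* pred q ℕ.* planes-through x
    count-InPlaneOfC {x} = ℕ.≤-trans (count-⋃ (inPlaneOfC? x) (inPlaneOf? x) (λ _ h → h))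
      (ℕ.≤-trans (sum-mono per-plane) (ℕ.≤-reflexive (≡.sym (*-distribˡ-sum (q ℕ.* pred q) (λ j → indicator (∈A j))))))
      where
      ∈A : ∀ j → Dec (A x ∈Span basis (pls j))
      ∈A j = ∈Span? (A x) (basis (pls j))
      per-plane : ∀ j → count (inPlaneOf? x j) ≤ q ℕ.* pred q ℕ.* indicator (∈A j)
      per-plane j = count-≤-*-indicator (inPlaneOf? x j) (∈A j) (λ _ → proj₁) λ Ax∈σ →
        ℕ.≤-trans (count-mono (inPlaneOf? x j) (inPlaneAvoidingC? (basis (pls j)) x) (λ _ → proj₂))
                  (count-InPlaneAvoidingC {x} (basis (pls j)) Ax∈σ)

    count-directions : ∀ {x} → ¬ MeetsC (A x ∷ []) →
                       q ^ 3 ≤ 1 ℕ.+ (r ℕ.* pred q ℕ.+ q ℕ.* pred q ℕ.* planes-through x)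
    count-directions {x} x∉C = begin
      q ^ 3
        ≤⟨ count-cover zero? other? (λ a → direction-cases x (vec a)) ⟩
      count zero? ℕ.+ count other?
        ≤⟨ ℕ.+-mono-≤ count-zero-vector (count-∪ other? (∃throughC? x) (inPlaneOfC? x) (λ _ h → h)) ⟩
      1 ℕ.+ (count (∃throughC? x) ℕ.+ count (inPlaneOfC? x))
        ≤⟨ ℕ.+-monoʳ-≤ 1 (ℕ.+-mono-≤ (count-∃ThroughC {x} x∉C) (count-InPlaneOfC {x})) ⟩
      1 ℕ.+ (r ℕ.* pred q ℕ.+ q ℕ.* pred q ℕ.* planes-through x)
        ∎
      where
      open ℕ.≤-Reasoning
      zero? : ∀ a → Dec (vec {3} a ≋ 0ᵥ)
      zero? a = vec a ≋? 0ᵥ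
      other? : ∀ a → Dec (∃[ i ] ThroughC x i (vec a) ⊎ InPlaneOfC x (vec a))
      other? a = ∃throughC? x a ⊎-dec inPlaneOfC? x a

    impossible-sizes : ∀ j → s ≡ q ℕ.* j → r ℕ.+ q ℕ.* j ≡ q ℕ.* (q ℕ.+ 1) → ⊥
    impossible-sizes j s≡qj r+qj≡q[q+1] =
      cover-counting-contradiction q r s j (count offC?) 2≤q s≡qj r+qj≡q[q+1] q³<N+r [j+1]N≤sq²
      where
      offC? : ∀ a → Dec (¬ MeetsC (A (vec a) ∷ []))
      offC? a = ¬? (inC? a)
      q³<N+r : q ^ 3 < count offC? ℕ.+ r
      q³<N+r = begin-strict
        q ^ 3                       ≤⟨ count-cover inC? offC? (λ a → toSum (inC? a)) ⟩
        count inC? ℕ.+ count offC?  <⟨ ℕ.+-monoˡ-< (count offC?) count-C-off-π ⟩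
        r ℕ.+ count offC?           ≡⟨ ℕ.+-comm r (count offC?) ⟩
        count offC? ℕ.+ r           ∎
        where open ℕ.≤-Reasoning
      j<planes-through : ∀ a → ¬ MeetsC (A (vec a) ∷ []) → suc j ≤ planes-through (vec a)
      j<planes-through a a∉C = directions-bound⇒j<t q r j _ 2≤q r+qj≡q[q+1] (count-directions {vec a} a∉C)
      [j+1]N≤sq² : suc j ℕ.* count offC? ≤ s ℕ.* q ^ 2
      [j+1]N≤sq² = begin
        suc j ℕ.* count offC?
          ≤⟨ *-count≤sum offC? (suc j) (planes-through ∘ vec) j<planes-through ⟩
        sum (planes-through ∘ vec)
          ≡⟨ ∑-count-comm (λ a j → ∈Span? (A (vec a)) (basis (pls j))) ⟩
        sum (λ j → count (λ a → ∈Span? (A (vec a)) (basis (pls j))))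
          ≤⟨ sum-≤-* (λ j → count-A-∈Span (basis (pls j))) ⟩
        s ℕ.* q ^ 2
          ∎
        where open ℕ.≤-Reasoning

open import Data.Integer using (ℤ; +_; _*_; _+_; _-_)
open import Data.Product using (Σ-syntax; _×_; _,_)
open import Relation.Nullary using (¬_)
open import Relation.Binary.PropositionalEquality using (_≡_)

mainTheorem10 : ∀ {c ℓ : Level} (q : ℕ) (F : FiniteField c ℓ q) (k : ℤ) (r s : ℕ)
    → (+ r) ≡ k * (+ q)
    → (+ s) ≡ (+ q) * ((+ q) + (+ 1) - k)
    → (C : Geometry.Cover F 4 r s)
    → ∀ (π : Geometry.Plane F 4)
    → Σ[ L ∈ Geometry.Line F 4 ] (Geometry._⊆S_ F L π × (∀ (i : Fin r) → ¬ Geometry._⊆S_ F (Geometry.Cover.pts C i) L))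
mainTheorem10 q F k r s r≡kq s≡q[q+1-k] C π
  with j , s≡qj , r+qj≡q[q+1] ← Arithmetic.cover-parameters q {{LinearAlgebra.q-nonZero F}} r s k r≡kq s≡q[q+1-k] =
  line-of-π-avoiding-C (λ every → impossible-sizes every j s≡qj r+qj≡q[q+1])
  where open CoverArgument F C π
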